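{- Let $m$ be a positive integer and $\lambda$ a nonzero real number. For integers $n,k\ge0$, $$\frac{1}{k!m^{k}}\sum_{l=0}^{k}\binom{k}{l}(-1)^{k-l}(lm+1)_{n,\lambda}=\begin{cases}W_{m,\lambda}(n,k),& n\ge k,\\ 0,& \text{otherwise.}\end{cases}$$
   Context: For a nonzero real $\lambda$: $(x)_{0,\lambda}=1$, $(x)_{n,\lambda}=x(x-\lambda)\cdots(x-(n-1)\lambda)$; $(x)_n=(x)_{n,1}$. Degenerate Whitney numbers of the second kind $W_{m,\lambda}(n,k)$ ($0\le k\le n$): $(mx+1)_{n,\lambda}=\sum_{k=0}^{n}W_{m,\lambda}(n,k)m^{k}(x)_{k}$. -}

module Defs where

open import Level using (Level; _⊔_) renaming (suc to lsuc)
open import Algebra.Bundles using (CommutativeRing)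
open import Data.Nat as ℕ using (ℕ; zero; suc)
open import Data.Nat.Combinatorics using (_C_)
open import Data.Product using (∃)
open import Relation.Nullary using (¬_)

record Field (c ℓ : Level) : Set (lsuc (c ⊔ ℓ)) where
  field
    commRing : CommutativeRing c ℓ
  open CommutativeRing commRing public
  field
    1≉0 : ¬ (1# ≈ 0#)
    inverse : ∀ x → ¬ (x ≈ 0#) → ∃ λ y → x * y ≈ 1#

module FieldOps {c ℓ : Level} (F : Field c ℓ) where
  open Field F public

  ι : ℕ → Carrier
  ι zero = 0#
  ι (suc n) = 1# + ι n

  CharZero : Set ℓ
  CharZero = ∀ n → ¬ (ι (suc n) ≈ 0#)

  pow : Carrier → ℕ → Carrier
  pow x zero = 1#
  pow x (suc n) = pow x n * x

  sumTo : ℕ → (ℕ → Carrier) → Carrier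
  sumTo zero f = f 0
  sumTo (suc n) f = sumTo n f + f (suc n)

  dfall : Carrier → Carrier → ℕ → Carrier
  dfall lam x zero = 1#
  dfall lam x (suc n) = dfall lam x n * (x - ι n * lam)

  fall : Carrier → ℕ → Carrier
  fall x n = dfall 1# x n

  -- W is (the family of) degenerate Whitney numbers of the second kind
  -- W_{m,λ}(n,k), 0 ≤ k ≤ n: for all n and all x,
  --   (m x + 1)_{n,λ} = Σ_{k=0}^{n} W(n,k) m^k (x)_k
  IsDegWhitney2 : ℕ → Carrier → (ℕ → ℕ → Carrier) → Set (c ⊔ ℓ)
  IsDegWhitney2 m lam W =
    ∀ (n : ℕ) (x : Carrier) →
      dfall lam (ι m * x + 1#) n ≈ sumTo n (λ k → W n k * pow (ι m) k * fall x k)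

  lhsSum : ℕ → Carrier → ℕ → ℕ → Carrier
  lhsSum m lam n k =
    sumTo k (λ l → ι (k C l) * pow (- 1#) (k ℕ.∸ l) * dfall lam (ι l * ι m + 1#) n)

-- Write f l = (l m + 1)_{n,λ}. The sum on the left is the k-th forward
-- difference (Δᵏ f)(0). By the defining expansion of W,
-- f l = Σ_j W(n,j) m^j (l)_j, and since Δ (l)_j = j (l)_{j-1} one gets
-- (Δᵏ (l)_j)(0) = k! if j = k and 0 otherwise. Hence the sum equals
-- k! m^k W(n,k) when k ≤ n and vanishes when k > n.
module Submission where

open import Defs
open import Data.Nat as ℕ using (ℕ; _!; _^_; _≤_; NonZero)
open import Relation.Nullary using (¬_)
open import Data.Product using (_×_)

open import Level using (Level)
open import Data.Nat using (zero; suc; z≤n; s≤s; _∸_; _≟_; _<?_)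
open import Data.Nat.Properties
  using (≤-refl; m≤n⇒m≤1+n; ≤∧≢⇒<; ≤-pred; n<1+n; ≮⇒≥; +-∸-assoc; 1+n≰n)
open import Data.Nat.Combinatorics using (_C_; nCk+nC[k+1]≡[n+1]C[k+1]; k>n⇒nCk≡0)
open import Data.Product using (_,_)
open import Data.Empty using (⊥-elim)
open import Function using (_∘_)
open import Relation.Nullary using (yes; no)
open import Relation.Binary.PropositionalEquality as ≡ using (_≡_; _≢_)
import Relation.Binary.Reasoning.Setoid as SetoidReasoning
import Algebra.Properties.Ring as RingProperties
import Algebra.Properties.CommutativeSemigroup as CommutativeSemigroupProperties

module FiniteDifferences {c ℓ : Level} (F : Field c ℓ) where
  open FieldOps F
  open SetoidReasoning setoid
  open RingProperties ring
    using (-0#≈0#; -‿+-comm; ⁻¹-anti-homo‿-; -‿distribˡ-*; -‿distribʳ-*;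
           x[y-z]≈xy-xz; [y-z]x≈yx-zx)
  open CommutativeSemigroupProperties +-commutativeSemigroup
    using (interchange) renaming (x∙yz≈y∙xz to x+[y+z]≈y+[x+z])
  open CommutativeSemigroupProperties *-commutativeSemigroup
    using () renaming (x∙yz≈y∙xz to x*[y*z]≈y*[x*z]; xy∙z≈x∙zy to [x*y]*z≈x*[z*y])

  sumTo-cong : ∀ n {f g : ℕ → Carrier} →
               (∀ j → j ≤ n → f j ≈ g j) → sumTo n f ≈ sumTo n g
  sumTo-cong zero    f≈g = f≈g 0 z≤n
  sumTo-cong (suc n) f≈g =
    +-cong (sumTo-cong n (λ j j≤n → f≈g j (m≤n⇒m≤1+n j≤n))) (f≈g (suc n) ≤-refl)

  sumTo-zero : ∀ n {f : ℕ → Carrier} → (∀ j → j ≤ n → f j ≈ 0#) → sumTo n f ≈ 0#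
  sumTo-zero n f≈0 = trans (sumTo-cong n f≈0) (sumTo-const-0 n)
    where
    sumTo-const-0 : ∀ n → sumTo n (λ _ → 0#) ≈ 0#
    sumTo-const-0 zero    = refl
    sumTo-const-0 (suc n) = trans (+-identityʳ _) (sumTo-const-0 n)

  sumTo-+ : ∀ n (f g : ℕ → Carrier) →
            sumTo n (λ j → f j + g j) ≈ sumTo n f + sumTo n g
  sumTo-+ zero    f g = refl
  sumTo-+ (suc n) f g = trans (+-congʳ (sumTo-+ n f g)) (interchange _ _ _ _)

  sumTo-neg : ∀ n (f : ℕ → Carrier) → sumTo n (λ j → - f j) ≈ - sumTo n f
  sumTo-neg zero    f = refl
  sumTo-neg (suc n) f = trans (+-congʳ (sumTo-neg n f)) (-‿+-comm _ _)

  sumTo-sub : ∀ n (f g : ℕ → Carrier) →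
              sumTo n (λ j → f j - g j) ≈ sumTo n f - sumTo n g
  sumTo-sub n f g = trans (sumTo-+ n f (λ j → - g j)) (+-congˡ (sumTo-neg n g))

  *-distribˡ-sumTo : ∀ n a (f : ℕ → Carrier) →
                     a * sumTo n f ≈ sumTo n (λ j → a * f j)
  *-distribˡ-sumTo zero    a f = refl
  *-distribˡ-sumTo (suc n) a f = trans (distribˡ a _ _) (+-congʳ (*-distribˡ-sumTo n a f))

  sumTo-unfoldˡ : ∀ n (f : ℕ → Carrier) →
                  sumTo (suc n) f ≈ f 0 + sumTo n (λ j → f (suc j))
  sumTo-unfoldˡ zero    f = refl
  sumTo-unfoldˡ (suc n) f = trans (+-congʳ (sumTo-unfoldˡ n f)) (+-assoc _ _ _)

  sumTo-comm : ∀ k n (h : ℕ → ℕ → Carrier) →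
               sumTo k (λ l → sumTo n (h l)) ≈ sumTo n (λ j → sumTo k (λ l → h l j))
  sumTo-comm zero    n h = refl
  sumTo-comm (suc k) n h = trans (+-congʳ (sumTo-comm k n h)) (sym (sumTo-+ n _ _))

  sumTo-single : ∀ n k {f : ℕ → Carrier} → k ≤ n →
                 (∀ j → j ≤ n → j ≢ k → f j ≈ 0#) → sumTo n f ≈ f k
  sumTo-single zero    zero    z≤n f≈0 = refl
  sumTo-single (suc n) k {f} k≤1+n f≈0 with k ≟ suc n
  ... | yes ≡.refl =
    trans (+-congʳ (sumTo-zero n (λ j j≤n → f≈0 j (m≤n⇒m≤1+n j≤n) (j≢1+n j≤n))))
          (+-identityˡ _)
    where
    j≢1+n : ∀ {j} → j ≤ n → j ≢ suc n
    j≢1+n j≤n ≡.refl = 1+n≰n j≤n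
  ... | no k≢1+n =
    trans (+-cong (sumTo-single n k (≤-pred (≤∧≢⇒< k≤1+n k≢1+n))
                    (λ j j≤n → f≈0 j (m≤n⇒m≤1+n j≤n)))
                  (f≈0 (suc n) ≤-refl (λ 1+n≡k → k≢1+n (≡.sym 1+n≡k))))
          (+-identityʳ _)

  ι-+ : ∀ a b → ι (a ℕ.+ b) ≈ ι a + ι b
  ι-+ zero    b = sym (+-identityˡ _)
  ι-+ (suc a) b = trans (+-congˡ (ι-+ a b)) (sym (+-assoc _ _ _))

  ι-* : ∀ a b → ι (a ℕ.* b) ≈ ι a * ι b
  ι-* zero    b = sym (zeroˡ _)
  ι-* (suc a) b = begin
    ι (b ℕ.+ a ℕ.* b)     ≈⟨ ι-+ b (a ℕ.* b) ⟩
    ι b + ι (a ℕ.* b)     ≈⟨ +-cong (sym (*-identityˡ _)) (ι-* a b) ⟩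
    1# * ι b + ι a * ι b  ≈⟨ distribʳ _ _ _ ⟨
    (1# + ι a) * ι b      ∎

  ι-^ : ∀ a k → ι (a ^ k) ≈ pow (ι a) k
  ι-^ a zero    = +-identityʳ 1#
  ι-^ a (suc k) = trans (ι-* a (a ^ k)) (trans (*-comm _ _) (*-congʳ (ι-^ a k)))

  sign : ℕ → Carrier
  sign = pow (- 1#)

  sign-suc : ∀ n → sign (suc n) ≈ - sign n
  sign-suc n = trans (sym (-‿distribʳ-* (sign n) 1#)) (-‿cong (*-identityʳ _))

  altBinomial : ℕ → ℕ → Carrier
  altBinomial k l = ι (k C l) * sign (k ∸ l)

  altBinomial-suc-zero : ∀ k → altBinomial (suc k) 0 ≈ - altBinomial k 0
  altBinomial-suc-zero k = trans (*-congˡ (sign-suc k)) (sym (-‿distribʳ-* _ _))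

  altBinomial-above : ∀ k → altBinomial k (suc k) ≈ 0#
  altBinomial-above k =
    trans (*-congʳ (reflexive (≡.cong ι (k>n⇒nCk≡0 (n<1+n k))))) (zeroˡ _)

  -- The sign exponent drops by one except when k C (l + 1) = 0 anyway.
  binomial-sign-shift : ∀ k l → ι (k C suc l) * sign (k ∸ l) ≈ - altBinomial k (suc l)
  binomial-sign-shift k l with l <? k
  ... | yes l<k = begin
    ι (k C suc l) * sign (k ∸ l)
      ≈⟨ *-congˡ (reflexive (≡.cong sign (+-∸-assoc 1 l<k))) ⟩
    ι (k C suc l) * sign (suc (k ∸ suc l))
      ≈⟨ *-congˡ (sign-suc (k ∸ suc l)) ⟩
    ι (k C suc l) * - sign (k ∸ suc l)
      ≈⟨ -‿distribʳ-* _ _ ⟨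
    - altBinomial k (suc l) ∎
  ... | no l≮k = begin
    ι (k C suc l) * sign (k ∸ l)  ≈⟨ *-congʳ ι[kC1+l]≈0 ⟩
    0# * sign (k ∸ l)             ≈⟨ zeroˡ _ ⟩
    0#                            ≈⟨ -0#≈0# ⟨
    - 0#                          ≈⟨ -‿cong (trans (*-congʳ ι[kC1+l]≈0) (zeroˡ _)) ⟨
    - altBinomial k (suc l)       ∎
    where
    ι[kC1+l]≈0 : ι (k C suc l) ≈ 0#
    ι[kC1+l]≈0 = reflexive (≡.cong ι (k>n⇒nCk≡0 (s≤s (≮⇒≥ l≮k))))

  altBinomial-suc-suc : ∀ k l →
    altBinomial (suc k) (suc l) ≈ altBinomial k l - altBinomial k (suc l)
  altBinomial-suc-suc k l = begin
    ι (suc k C suc l) * sign (k ∸ l)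
      ≈⟨ *-congʳ (reflexive (≡.cong ι (nCk+nC[k+1]≡[n+1]C[k+1] k l))) ⟨
    ι (k C l ℕ.+ k C suc l) * sign (k ∸ l)
      ≈⟨ *-congʳ (ι-+ (k C l) (k C suc l)) ⟩
    (ι (k C l) + ι (k C suc l)) * sign (k ∸ l)
      ≈⟨ distribʳ _ _ _ ⟩
    altBinomial k l + ι (k C suc l) * sign (k ∸ l)
      ≈⟨ +-congˡ (binomial-sign-shift k l) ⟩
    altBinomial k l - altBinomial k (suc l) ∎

  Δ : (ℕ → Carrier) → ℕ → Carrier
  Δ f l = f (suc l) - f l

  -- (Δᵏ f)(0) in closed form; Δ₀-suc shows that it is the iterated difference.
  Δ₀ : ℕ → (ℕ → Carrier) → Carrier
  Δ₀ k f = sumTo k (λ l → altBinomial k l * f l)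

  Δ₀-zero : ∀ f → Δ₀ 0 f ≈ f 0
  Δ₀-zero f = trans (*-congʳ (trans (*-identityʳ _) (+-identityʳ 1#))) (*-identityˡ _)

  Δ₀-cong : ∀ k {f g : ℕ → Carrier} → (∀ l → f l ≈ g l) → Δ₀ k f ≈ Δ₀ k g
  Δ₀-cong k f≈g = sumTo-cong k (λ l _ → *-congˡ (f≈g l))

  Δ₀-scale : ∀ k a (f : ℕ → Carrier) → Δ₀ k (λ l → a * f l) ≈ a * Δ₀ k f
  Δ₀-scale k a f =
    trans (sumTo-cong k (λ l _ → x*[y*z]≈y*[x*z] _ _ _)) (sym (*-distribˡ-sumTo k a _))

  Δ₀-sumTo : ∀ k n (h : ℕ → ℕ → Carrier) →
             Δ₀ k (λ l → sumTo n (λ j → h j l)) ≈ sumTo n (λ j → Δ₀ k (h j))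
  Δ₀-sumTo k n h =
    trans (sumTo-cong k (λ l _ → *-distribˡ-sumTo n (altBinomial k l) _)) (sumTo-comm k n _)

  -[x]+[y-z]≈y-[x+z] : ∀ x y z → - x + (y - z) ≈ y - (x + z)
  -[x]+[y-z]≈y-[x+z] x y z = trans (x+[y+z]≈y+[x+z] _ _ _) (+-congˡ (-‿+-comm x z))

  Δ₀-suc : ∀ k f → Δ₀ (suc k) f ≈ Δ₀ k (Δ f)
  Δ₀-suc k f = begin
    Δ₀ (suc k) f
      ≈⟨ sumTo-unfoldˡ k _ ⟩
    altBinomial (suc k) 0 * f 0 + sumTo k (λ l → altBinomial (suc k) (suc l) * f (suc l))
      ≈⟨ +-cong (*-congʳ (altBinomial-suc-zero k))
                (sumTo-cong k (λ l _ → trans (*-congʳ (altBinomial-suc-suc k l))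
                                             ([y-z]x≈yx-zx _ _ _))) ⟩
    - altBinomial k 0 * f 0 + sumTo k (λ l → a l * f (suc l) - a (suc l) * f (suc l))
      ≈⟨ +-cong (sym (-‿distribˡ-* _ _)) (sumTo-sub k _ _) ⟩
    - (a 0 * f 0) + (sumTo k (λ l → a l * f (suc l)) - sumTo k (λ l → a (suc l) * f (suc l)))
      ≈⟨ -[x]+[y-z]≈y-[x+z] _ _ _ ⟩
    sumTo k (λ l → a l * f (suc l)) - (a 0 * f 0 + sumTo k (λ l → a (suc l) * f (suc l)))
      ≈⟨ +-congˡ (-‿cong (trans (sym (sumTo-unfoldˡ k _)) top-vanishes)) ⟩
    sumTo k (λ l → a l * f (suc l)) - Δ₀ k f
      ≈⟨ sumTo-sub k _ _ ⟨
    sumTo k (λ l → a l * f (suc l) - a l * f l)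
      ≈⟨ sumTo-cong k (λ l _ → x[y-z]≈xy-xz _ _ _) ⟨
    Δ₀ k (Δ f) ∎
    where
    a : ℕ → Carrier
    a = altBinomial k
    top-vanishes : sumTo (suc k) (λ l → a l * f l) ≈ Δ₀ k f
    top-vanishes =
      trans (+-congˡ (trans (*-congʳ (altBinomial-above k)) (zeroˡ _))) (+-identityʳ _)

  fall-suc : ∀ x j → fall x (suc j) ≈ fall x j * (x - ι j)
  fall-suc x j = *-congˡ (+-congˡ (-‿cong (*-identityʳ _)))

  fall-0# : ∀ j → fall 0# (suc j) ≈ 0#
  fall-0# zero    = trans (fall-suc 0# 0) (trans (*-congˡ 0#-0#≈0#) (zeroʳ _))
    where
    0#-0#≈0# : 0# - 0# ≈ 0#
    0#-0#≈0# = trans (+-identityˡ _) -0#≈0#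
  fall-0# (suc j) = trans (*-congʳ (fall-0# j)) (zeroˡ _)

  [1+x]-[1+y]≈x-y : ∀ x y → (1# + x) - (1# + y) ≈ x - y
  [1+x]-[1+y]≈x-y x y = begin
    (1# + x) - (1# + y)       ≈⟨ +-congˡ (-‿+-comm 1# y) ⟨
    (1# + x) + (- 1# + - y)   ≈⟨ interchange _ _ _ _ ⟩
    (1# - 1#) + (x - y)       ≈⟨ +-congʳ (-‿inverseʳ 1#) ⟩
    0# + (x - y)              ≈⟨ +-identityˡ _ ⟩
    x - y                     ∎

  [1+x]-[x-y]≈1+y : ∀ x y → (1# + x) - (x - y) ≈ 1# + y
  [1+x]-[x-y]≈1+y x y = begin
    (1# + x) - (x - y)        ≈⟨ +-congˡ (⁻¹-anti-homo‿- x y) ⟩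
    (1# + x) + (y - x)        ≈⟨ +-assoc _ _ _ ⟩
    1# + (x + (y - x))        ≈⟨ +-congˡ (x+[y+z]≈y+[x+z] _ _ _) ⟩
    1# + (y + (x - x))        ≈⟨ +-congˡ (trans (+-congˡ (-‿inverseʳ x)) (+-identityʳ y)) ⟩
    1# + y                    ∎

  fall-1+ : ∀ x j → fall (1# + x) (suc j) ≈ (1# + x) * fall x j
  fall-1+ x zero    = begin
    fall (1# + x) 1           ≈⟨ fall-suc (1# + x) 0 ⟩
    1# * ((1# + x) - 0#)      ≈⟨ *-identityˡ _ ⟩
    (1# + x) - 0#             ≈⟨ trans (+-congˡ -0#≈0#) (+-identityʳ _) ⟩
    1# + x                    ≈⟨ *-identityʳ _ ⟨
    (1# + x) * 1#             ∎
  fall-1+ x (suc j) = begin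
    fall (1# + x) (suc (suc j))            ≈⟨ fall-suc (1# + x) (suc j) ⟩
    fall (1# + x) (suc j) * ((1# + x) - (1# + ι j))
      ≈⟨ *-cong (fall-1+ x j) ([1+x]-[1+y]≈x-y x (ι j)) ⟩
    (1# + x) * fall x j * (x - ι j)        ≈⟨ *-assoc _ _ _ ⟩
    (1# + x) * (fall x j * (x - ι j))      ≈⟨ *-congˡ (fall-suc x j) ⟨
    (1# + x) * fall x (suc j)              ∎

  fallℕ : ℕ → ℕ → Carrier
  fallℕ j l = fall (ι l) j

  Δ-fallℕ : ∀ j l → Δ (fallℕ (suc j)) l ≈ ι (suc j) * fallℕ j l
  Δ-fallℕ j l = begin
    fall (1# + x) (suc j) - fall x (suc j)  ≈⟨ +-cong (fall-1+ x j) (-‿cong (fall-suc x j)) ⟩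
    (1# + x) * y - y * (x - ι j)            ≈⟨ +-congʳ (*-comm _ _) ⟩
    y * (1# + x) - y * (x - ι j)            ≈⟨ x[y-z]≈xy-xz _ _ _ ⟨
    y * ((1# + x) - (x - ι j))              ≈⟨ *-congˡ ([1+x]-[x-y]≈1+y x (ι j)) ⟩
    y * (1# + ι j)                          ≈⟨ *-comm _ _ ⟩
    ι (suc j) * y                           ∎
    where
    x y : Carrier
    x = ι l
    y = fallℕ j l

  Δ₀-fallℕ-suc : ∀ k j → Δ₀ (suc k) (fallℕ (suc j)) ≈ ι (suc j) * Δ₀ k (fallℕ j)
  Δ₀-fallℕ-suc k j =
    trans (Δ₀-suc k (fallℕ (suc j))) (trans (Δ₀-cong k (Δ-fallℕ j)) (Δ₀-scale k _ _))

  Δ₀-fallℕ-same : ∀ k → Δ₀ k (fallℕ k) ≈ ι (k !)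
  Δ₀-fallℕ-same zero    = trans (Δ₀-zero (fallℕ 0)) (sym (+-identityʳ 1#))
  Δ₀-fallℕ-same (suc k) = begin
    Δ₀ (suc k) (fallℕ (suc k))      ≈⟨ Δ₀-fallℕ-suc k k ⟩
    ι (suc k) * Δ₀ k (fallℕ k)      ≈⟨ *-congˡ (Δ₀-fallℕ-same k) ⟩
    ι (suc k) * ι (k !)             ≈⟨ ι-* (suc k) (k !) ⟨
    ι (suc k !)                     ∎

  Δ₀-fallℕ-other : ∀ k j → j ≢ k → Δ₀ k (fallℕ j) ≈ 0#
  Δ₀-fallℕ-other zero    zero    0≢0   = ⊥-elim (0≢0 ≡.refl)
  Δ₀-fallℕ-other zero    (suc j) _     = trans (Δ₀-zero (fallℕ (suc j))) (fall-0# j)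
  Δ₀-fallℕ-other (suc k) zero    _     =
    trans (Δ₀-suc k (fallℕ 0))
          (sumTo-zero k (λ l _ → trans (*-congˡ (-‿inverseʳ 1#)) (zeroʳ _)))
  Δ₀-fallℕ-other (suc k) (suc j) 1+j≢1+k = begin
    Δ₀ (suc k) (fallℕ (suc j))      ≈⟨ Δ₀-fallℕ-suc k j ⟩
    ι (suc j) * Δ₀ k (fallℕ j)      ≈⟨ *-congˡ (Δ₀-fallℕ-other k j (1+j≢1+k ∘ ≡.cong suc)) ⟩
    ι (suc j) * 0#                  ≈⟨ zeroʳ _ ⟩
    0#                              ∎

  dfall-cong : ∀ lam n {x y} → x ≈ y → dfall lam x n ≈ dfall lam y n
  dfall-cong lam zero    x≈y = refl
  dfall-cong lam (suc n) x≈y = *-cong (dfall-cong lam n x≈y) (+-congʳ x≈y)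

  module _ {m : ℕ} {lam : Carrier} {W : ℕ → ℕ → Carrier}
           (isW : IsDegWhitney2 m lam W) (n k : ℕ) where

    lhsSum-expansion :
      lhsSum m lam n k ≈ sumTo n (λ j → W n j * pow (ι m) j * Δ₀ k (fallℕ j))
    lhsSum-expansion = begin
      lhsSum m lam n k
        ≡⟨⟩
      Δ₀ k (λ l → dfall lam (ι l * ι m + 1#) n)
        ≈⟨ Δ₀-cong k (λ l → trans (dfall-cong lam n (+-congʳ (*-comm _ _))) (isW n (ι l))) ⟩
      Δ₀ k (λ l → sumTo n (λ j → W n j * pow (ι m) j * fallℕ j l))
        ≈⟨ Δ₀-sumTo k n _ ⟩
      sumTo n (λ j → Δ₀ k (λ l → W n j * pow (ι m) j * fallℕ j l))
        ≈⟨ sumTo-cong n (λ j _ → Δ₀-scale k _ _) ⟩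
      sumTo n (λ j → W n j * pow (ι m) j * Δ₀ k (fallℕ j)) ∎

    lhsSum-≤ : k ≤ n → lhsSum m lam n k ≈ W n k * ι (k ! ℕ.* m ^ k)
    lhsSum-≤ k≤n = begin
      lhsSum m lam n k
        ≈⟨ lhsSum-expansion ⟩
      sumTo n (λ j → W n j * pow (ι m) j * Δ₀ k (fallℕ j))
        ≈⟨ sumTo-single n k k≤n (λ j _ j≢k →
             trans (*-congˡ (Δ₀-fallℕ-other k j j≢k)) (zeroʳ _)) ⟩
      W n k * pow (ι m) k * Δ₀ k (fallℕ k)
        ≈⟨ *-congˡ (Δ₀-fallℕ-same k) ⟩
      W n k * pow (ι m) k * ι (k !)
        ≈⟨ [x*y]*z≈x*[z*y] _ _ _ ⟩
      W n k * (ι (k !) * pow (ι m) k)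
        ≈⟨ *-congˡ (trans (ι-* (k !) (m ^ k)) (*-congˡ (ι-^ m k))) ⟨
      W n k * ι (k ! ℕ.* m ^ k) ∎

    lhsSum-≰ : ¬ (k ≤ n) → lhsSum m lam n k ≈ 0#
    lhsSum-≰ k≰n = trans lhsSum-expansion (sumTo-zero n (λ j j≤n →
      trans (*-congˡ (Δ₀-fallℕ-other k j (λ { ≡.refl → k≰n j≤n }))) (zeroʳ _)))

-- lhsSum-≤ and lhsSum-≰ hold in every commutative ring; the field
-- hypotheses serve only to provide the inverse d of k! m^k.
theorem12 : ∀ {c ℓ} (F : Field c ℓ) → let open FieldOps F in
    CharZero →
    (m : ℕ) → .{{_ : NonZero m}} →
    (lam : Carrier) → ¬ (lam ≈ 0#) →
    (W : ℕ → ℕ → Carrier) → IsDegWhitney2 m lam W →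
    (n k : ℕ) →
    (d : Carrier) → d * ι (k ! ℕ.* m ^ k) ≈ 1# →
    ((k ≤ n → d * lhsSum m lam n k ≈ W n k)
    × (¬ (k ≤ n) → d * lhsSum m lam n k ≈ 0#))
theorem12 F _ m lam _ W isW n k d d-inverse = below , above
  where
  open FieldOps F
  open FiniteDifferences F
  open SetoidReasoning setoid
  open CommutativeSemigroupProperties *-commutativeSemigroup using (x∙yz≈y∙xz)

  below : k ≤ n → d * lhsSum m lam n k ≈ W n k
  below k≤n = begin
    d * lhsSum m lam n k                ≈⟨ *-congˡ (lhsSum-≤ isW n k k≤n) ⟩
    d * (W n k * ι (k ! ℕ.* m ^ k))     ≈⟨ x∙yz≈y∙xz _ _ _ ⟩
    W n k * (d * ι (k ! ℕ.* m ^ k))     ≈⟨ *-congˡ d-inverse ⟩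
    W n k * 1#                          ≈⟨ *-identityʳ _ ⟩
    W n k                               ∎

  above : ¬ (k ≤ n) → d * lhsSum m lam n k ≈ 0#
  above k≰n = trans (*-congˡ (lhsSum-≰ {m} isW n k k≰n)) (zeroʳ d)
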